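{- Let $G$ and $H$ be finite, simple, connected graphs. Then $\dim_f(G\Box H)\leq \max\{\dim_f(G),|V(H)|\}$.
   Context: The cartesian product $G\Box H$ has vertex set $V(G)\times V(H)$, with $(u_1,v_1)$ adjacent to $(u_2,v_2)$ iff either $u_1=u_2$ and $v_1v_2\in E(H)$, or $v_1=v_2$ and $u_1u_2\in E(G)$. For vertices $x,y$ of a connected graph $G$, $R\{x,y\}$ is the set of $z$ with $d(x,z)\neq d(y,z)$. A resolving function of $G$ is $f:V(G)\to[0,1]$ with $\sum_{z\in R\{x,y\}}f(z)\geq 1$ for all distinct $x,y$; $\dim_f(G)$ is the minimum of $\sum_{v\in V(G)}f(v)$ over all resolving functions.
   Formalization: Resolving functions take rational values in [0,1] rather than real values, so $\dim_f(G)$ and $\dim_f(G\Box H)$ are minima over such functions. -}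

module Defs where

open import Data.Bool using (Bool; true; false; _∧_; _∨_; if_then_else_)
open import Data.Nat as ℕ using (ℕ; zero; suc; _≡ᵇ_)
open import Data.Fin as Fin using (Fin; remQuot)
open import Data.Fin.Properties using (_≟_)
open import Data.Product using (_×_; _,_; proj₁; proj₂; ∃)
open import Data.Integer using (+_)
open import Data.Rational as ℚ using (ℚ; 0ℚ; 1ℚ; _≤_; _/_)
open import Relation.Binary.PropositionalEquality using (_≡_; _≢_)
open import Relation.Nullary.Decidable using (⌊_⌋)

record Graph : Set where
  field
    n   : ℕ
    adj : Fin n → Fin n → Bool
open Graph public

Simple : Graph → Set
Simple G = (∀ u v → adj G u v ≡ adj G v u) × (∀ u → adj G u u ≡ false)

data Walk (G : Graph) : Fin (n G) → Fin (n G) → ℕ → Set where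
  [] : ∀ {u} → Walk G u u 0
  _∷_ : ∀ {u v w k} → adj G u v ≡ true → Walk G v w k → Walk G u w (suc k)

Connected : Graph → Set
Connected G = ∀ u v → ∃ λ k → Walk G u v k

anyFin : ∀ {m} → (Fin m → Bool) → Bool
anyFin {zero}  p = false
anyFin {suc m} p = p Fin.zero ∨ anyFin (λ i → p (Fin.suc i))

ball : (G : Graph) → ℕ → Fin (n G) → Fin (n G) → Bool
ball G zero    x y = ⌊ x ≟ y ⌋
ball G (suc k) x y = ball G k x y ∨ anyFin (λ w → ball G k x w ∧ adj G w y)

-- least k < b with p k (or b if none)
firstTrue : ℕ → (ℕ → Bool) → ℕ
firstTrue zero    p = zero
firstTrue (suc b) p = if p zero then zero else suc (firstTrue b (λ k → p (suc k)))

-- Graph distance: least k with a walk of length ≤ k from x to y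
-- (for connected graphs this is < n, so the bound n is never reached).
dist : (G : Graph) → Fin (n G) → Fin (n G) → ℕ
dist G x y = firstTrue (n G) (λ k → ball G k x y)

-- Cartesian product G □ H on Fin (n G * n H), vertex (u,v) ↦ combine u v.
_□_ : Graph → Graph → Graph
G □ H = record
  { n   = n G ℕ.* n H
  ; adj = λ i j → step (remQuot (n H) i) (remQuot (n H) j)
  }
  where
  step : Fin (n G) × Fin (n H) → Fin (n G) × Fin (n H) → Bool
  step (u₁ , v₁) (u₂ , v₂) =
    (⌊ u₁ ≟ u₂ ⌋ ∧ adj H v₁ v₂) ∨ (⌊ v₁ ≟ v₂ ⌋ ∧ adj G u₁ u₂)

sumℚ : ∀ {m} → (Fin m → ℚ) → ℚ
sumℚ {zero}  f = 0ℚ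
sumℚ {suc m} f = f Fin.zero ℚ.+ sumℚ (λ i → f (Fin.suc i))

weightR : (G : Graph) → (Fin (n G) → ℚ) → Fin (n G) → Fin (n G) → ℚ
weightR G f x y = sumℚ (λ z → if dist G x z ≡ᵇ dist G y z then 0ℚ else f z)

Resolving : (G : Graph) → (Fin (n G) → ℚ) → Set
Resolving G f =
  (∀ v → (0ℚ ≤ f v) × (f v ≤ 1ℚ)) ×
  (∀ x y → x ≢ y → 1ℚ ≤ weightR G f x y)

IsFracDim : Graph → ℚ → Set
IsFracDim G d =
  (∃ λ f → Resolving G f × sumℚ f ≡ d) ×
  (∀ f → Resolving G f → d ≤ sumℚ f)

ℕtoℚ : ℕ → ℚ
ℕtoℚ k = (+ k) / 1

-- Distances add up in the product: d((u,v),(u′,v′)) = d_G(u,u′) + d_H(v,v′). Let g be an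
-- optimal resolving function of G and m = |V(H)|. Pick q : V(G) → [0,1] with g ≤ m q and
-- Σ q ≥ 1: q = g / m when dim_f(G) ≥ m, otherwise g / m plus the missing mass 1 − Σ g / m on
-- one vertex; in both cases m Σ q = max(dim_f(G), m). Give every vertex (w,z) the weight q(w).
-- Two vertices of one layer G × {v} are resolved by (w,z) exactly when w resolves them in G,
-- and each fibre {w} × V(H) carries m q(w) ≥ g(w). Two vertices in layers v ≠ v′ are resolved
-- in every fibre by (w,v) or by (w,v′), as d_H(v,v′) and d_H(v′,v) do not both vanish, so
-- they receive weight at least Σ q ≥ 1.

module Submission where

open import Defs
open import Algebra.Bundles using (CommutativeMonoid)
open import Data.Bool using (Bool; true; false; T; _∧_; _∨_; if_then_else_)
open import Data.Bool.Properties using (T-∧; T-∨; T-≡)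
open import Data.Empty using (⊥-elim)
open import Data.Fin as Fin using (Fin; zero; suc; toℕ; combine; remQuot; _↑ˡ_; _↑ʳ_)
open import Data.Fin.Properties using (_≟_; pigeonhole; remQuot-combine; combine-remQuot; toℕ<n)
open import Data.Integer as ℤ using (_◃_)
open import Data.Integer.Properties using (+◃n≡+n)
open import Data.Nat as ℕ using (ℕ; zero; suc; _≡ᵇ_; z≤n; s≤s)
open import Data.Nat.Coprimality using (1-coprimeTo)
import Data.Nat.Coprimality as Coprime
open import Data.Nat.Induction using (<-wellFounded)
import Data.Nat.Properties as ℕ
open import Data.Product using (_×_; _,_; proj₁; proj₂; ∃; ∃₂)
open import Data.Rational using (ℚ; 0ℚ; 1ℚ; _≤_; _+_; _*_; _-_; _⊔_; _/_; 1/_; mkℚ; NonZero; Positive; positive; -_; *≤*; *<*)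
open import Data.Rational.Properties hiding (_≟_)
open import Algebra.Properties.CommutativeSemigroup (CommutativeMonoid.commutativeSemigroup +-0-commutativeMonoid)
  using (interchange)
open import Data.Sign using (Sign)
open import Data.Sum using (_⊎_; inj₁; inj₂; [_,_]′)
open import Function using (_∘_; Equivalence; mk⇔)
open import Induction.WellFounded using (Acc; acc)
open import Relation.Binary.PropositionalEquality
open import Relation.Nullary using (¬_; yes; no; does)
open import Relation.Nullary.Decidable using (⌊_⌋; toWitness; fromWitness; dec-false; does-⇔)

open Equivalence using (to; from)

-- Walks and distances

anyFin-witness : ∀ {m} (p : Fin m → Bool) → T (anyFin p) → ∃ λ i → T (p i)
anyFin-witness {zero}  p ()
anyFin-witness {suc m} p t with to T-∨ t
... | inj₁ t₀ = zero , t₀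
... | inj₂ t₊ = let i , tᵢ = anyFin-witness (p ∘ suc) t₊ in suc i , tᵢ

anyFin-intro : ∀ {m} (p : Fin m → Bool) i → T (p i) → T (anyFin p)
anyFin-intro p zero    t = from T-∨ (inj₁ t)
anyFin-intro p (suc i) t = from T-∨ (inj₂ (anyFin-intro (p ∘ suc) i t))

firstTrue-≤ : ∀ b p → firstTrue b p ℕ.≤ b
firstTrue-≤ zero    p = z≤n
firstTrue-≤ (suc b) p with p 0
... | true  = z≤n
... | false = s≤s (firstTrue-≤ b (p ∘ suc))

firstTrue-minimal : ∀ b p {k} → k ℕ.< b → T (p k) → firstTrue b p ℕ.≤ k
firstTrue-minimal (suc b) p {k} k<b t with p 0 in p0
... | true = z≤n
firstTrue-minimal (suc b) p {zero}  k<b       t | false = ⊥-elim (subst T p0 t)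
firstTrue-minimal (suc b) p {suc k} (s≤s k<b) t | false = s≤s (firstTrue-minimal b (p ∘ suc) k<b t)

firstTrue-holds : ∀ b p → firstTrue b p ℕ.< b → T (p (firstTrue b p))
firstTrue-holds (suc b) p lt with p 0 in p0
... | true  = subst T (sym p0) _
... | false = firstTrue-holds b (p ∘ suc) (ℕ.≤-pred lt)

_++ʷ_ : ∀ {G x y z a b} → Walk G x y a → Walk G y z b → Walk G x z (a ℕ.+ b)
[]      ++ʷ W = W
(e ∷ V) ++ʷ W = e ∷ (V ++ʷ W)

snocʷ : ∀ {G x w y j} → Walk G x w j → adj G w y ≡ true → Walk G x y (suc j)
snocʷ []       e = e ∷ []
snocʷ (e′ ∷ W) e = e′ ∷ snocʷ W e

unsnocʷ : ∀ {G x y j} → Walk G x y (suc j) → ∃ λ w → Walk G x w j × adj G w y ≡ true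
unsnocʷ (e ∷ [])       = _ , [] , e
unsnocʷ (e ∷ (e′ ∷ W)) = let w , W′ , e″ = unsnocʷ (e′ ∷ W) in w , e ∷ W′ , e″

ball-complete : ∀ {G x y j} → Walk G x y j → T (ball G j x y)
ball-complete {j = zero}  []            = fromWitness refl
ball-complete {j = suc j} W with unsnocʷ W
... | w , W′ , e = from T-∨ (inj₂ (anyFin-intro _ w (from T-∧ (ball-complete W′ , from T-≡ e))))

ball-sound : ∀ G k {x y} → T (ball G k x y) → ∃ λ j → j ℕ.≤ k × Walk G x y j
ball-sound G zero    t with toWitness t
... | refl = 0 , z≤n , []
ball-sound G (suc k) {x} {y} t with to T-∨ t
... | inj₁ t′ = let j , j≤k , W = ball-sound G k t′ in j , ℕ.m≤n⇒m≤1+n j≤k , W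
... | inj₂ t′ =
  let w , t″      = anyFin-witness (λ w → ball G k x w ∧ adj G w y) t′
      tw , e      = to T-∧ t″
      j , j≤k , W = ball-sound G k tw
  in suc j , s≤s j≤k , snocʷ W (to T-≡ e)

vertexAt : ∀ {G u w k} → Walk G u w k → Fin (suc k) → Fin (n G)
vertexAt {u = u} W       zero    = u
vertexAt         (_ ∷ W) (suc i) = vertexAt W i

suffixFrom : ∀ {G u w k} (W : Walk G u w k) i → Walk G (vertexAt W i) w (k ℕ.∸ toℕ i)
suffixFrom W       zero    = W
suffixFrom (_ ∷ W) (suc i) = suffixFrom W i

remove-cycle : ∀ {G u w k} (W : Walk G u w k) {i j} → i Fin.< j → vertexAt W i ≡ vertexAt W j →
               ∃ λ k′ → k′ ℕ.< k × Walk G u w k′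
remove-cycle {k = suc k} W {zero} {suc j} _ same =
  k ℕ.∸ toℕ j , s≤s (ℕ.m∸n≤m k (toℕ j)) , subst (λ v → Walk _ v _ _) (sym same) (suffixFrom W (suc j))
remove-cycle (e ∷ W) {suc i} {suc j} (s≤s i<j) same =
  let k′ , k′<k , W′ = remove-cycle W i<j same in suc k′ , s≤s k′<k , e ∷ W′

shorten : ∀ {G u w k} → Acc ℕ._<_ k → Walk G u w k → ∃ λ j → j ℕ.< n G × Walk G u w j
shorten {G} {k = k} (acc smaller) W with k ℕ.<? n G
... | yes k<n = k , k<n , W
... | no  k≮n =
  let i , j , i<j , same = pigeonhole (s≤s (ℕ.≮⇒≥ k≮n)) (vertexAt W)
      k′ , k′<k , W′     = remove-cycle W i<j same
  in shorten (smaller k′<k) W′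

dist-≤-length : ∀ {G x y j} → Walk G x y j → dist G x y ℕ.≤ j
dist-≤-length {G} {j = j} W with j ℕ.<? n G
... | yes j<n = firstTrue-minimal (n G) _ j<n (ball-complete W)
... | no  j≮n = ℕ.≤-trans (firstTrue-≤ (n G) _) (ℕ.≮⇒≥ j≮n)

walk-of-length-dist : ∀ {G x y k} → Walk G x y k → Walk G x y (dist G x y)
walk-of-length-dist {G} {x} {y} W =
  let j , j<n , W′ = shorten (<-wellFounded _) W
      i , i≤d , W″ = ball-sound G (dist G x y)
                       (firstTrue-holds (n G) _ (ℕ.≤-<-trans (dist-≤-length W′) j<n))
  in subst (Walk G x y) (ℕ.≤-antisym i≤d (dist-≤-length W″)) W″

dist-refl : ∀ {G} x → dist G x x ≡ 0
dist-refl {G} x = ℕ.n≤0⇒n≡0 (dist-≤-length {G} [])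

dist-≢0 : ∀ {G x y} → x ≢ y → dist G x y ≢ 0
dist-≢0 {G} {x} {y} x≢y d≡0 = x≢y (toWitness (subst (λ k → T (ball G k x y)) d≡0 ball-d))
  where
  ball-d : T (ball G (dist G x y) x y)
  ball-d = firstTrue-holds (n G) _ (subst (ℕ._< n G) (sym d≡0) (ℕ.≤-<-trans z≤n (toℕ<n x)))

-- Distances in the cartesian product

module _ (G H : Graph) where

  cell : Fin (n (G □ H)) → Fin (n G) × Fin (n H)
  cell = remQuot (n H)

  cellAdj : Fin (n G) × Fin (n H) → Fin (n G) × Fin (n H) → Bool
  cellAdj (u , v) (u′ , v′) = (⌊ u ≟ u′ ⌋ ∧ adj H v v′) ∨ (⌊ v ≟ v′ ⌋ ∧ adj G u u′)

  cellAdj-cases : ∀ p q → cellAdj p q ≡ true →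
                  (proj₁ p ≡ proj₁ q × adj H (proj₂ p) (proj₂ q) ≡ true) ⊎
                  (proj₂ p ≡ proj₂ q × adj G (proj₁ p) (proj₁ q) ≡ true)
  cellAdj-cases (u , v) (u′ , v′) e
    with to (T-∨ {⌊ u ≟ u′ ⌋ ∧ adj H v v′} {⌊ v ≟ v′ ⌋ ∧ adj G u u′}) (from T-≡ e)
  ... | inj₁ t = let same , step = to (T-∧ {⌊ u ≟ u′ ⌋}) t in inj₁ (toWitness same , to T-≡ step)
  ... | inj₂ t = let same , step = to (T-∧ {⌊ v ≟ v′ ⌋}) t in inj₂ (toWitness same , to T-≡ step)

  □-adj-combine : ∀ u v u′ v′ → adj (G □ H) (combine u v) (combine u′ v′) ≡ cellAdj (u , v) (u′ , v′)
  □-adj-combine u v u′ v′ = cong₂ cellAdj (remQuot-combine u v) (remQuot-combine u′ v′)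

  □-edgeᴳ : ∀ {u u′} v → adj G u u′ ≡ true → adj (G □ H) (combine u v) (combine u′ v) ≡ true
  □-edgeᴳ {u} {u′} v e = trans (□-adj-combine u v u′ v)
    (to T-≡ (from (T-∨ {⌊ u ≟ u′ ⌋ ∧ adj H v v}) (inj₂ (from T-∧ (fromWitness refl , from T-≡ e)))))

  □-edgeᴴ : ∀ u {v v′} → adj H v v′ ≡ true → adj (G □ H) (combine u v) (combine u v′) ≡ true
  □-edgeᴴ u {v} {v′} e = trans (□-adj-combine u v u v′)
    (to T-≡ (from (T-∨ {⌊ u ≟ u ⌋ ∧ adj H v v′}) (inj₁ (from T-∧ (fromWitness refl , from T-≡ e)))))

  liftᴳ : ∀ {u u′ a} v → Walk G u u′ a → Walk (G □ H) (combine u v) (combine u′ v) a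
  liftᴳ v []      = []
  liftᴳ v (e ∷ W) = □-edgeᴳ v e ∷ liftᴳ v W

  liftᴴ : ∀ u {v v′ b} → Walk H v v′ b → Walk (G □ H) (combine u v) (combine u v′) b
  liftᴴ u []      = []
  liftᴴ u (e ∷ W) = □-edgeᴴ u e ∷ liftᴴ u W

  project : ∀ {x y j} → Walk (G □ H) x y j →
            ∃₂ λ a b → a ℕ.+ b ≡ j × Walk G (proj₁ (cell x)) (proj₁ (cell y)) a
                                    × Walk H (proj₂ (cell x)) (proj₂ (cell y)) b
  project [] = 0 , 0 , refl , [] , []
  project {x} (_∷_ {v = y} e W) with project W | cellAdj-cases (cell x) (cell y) e
  ... | a , b , refl , Wᴳ , Wᴴ | inj₁ (same , step) =
    a , suc b , ℕ.+-suc a b , subst (λ u → Walk G u _ a) (sym same) Wᴳ , step ∷ Wᴴ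
  ... | a , b , refl , Wᴳ , Wᴴ | inj₂ (same , step) =
    suc a , b , refl , step ∷ Wᴳ , subst (λ v → Walk H v _ b) (sym same) Wᴴ

  project-combine : ∀ {u v u′ v′ j} → Walk (G □ H) (combine u v) (combine u′ v′) j →
                    ∃₂ λ a b → a ℕ.+ b ≡ j × Walk G u u′ a × Walk H v v′ b
  project-combine {u} {v} {u′} {v′} W =
    let a , b , a+b≡j , Wᴳ , Wᴴ = project W
    in a , b , a+b≡j , subst₂ (λ s t → Walk G s t a) (cell₁ u v) (cell₁ u′ v′) Wᴳ
                     , subst₂ (λ s t → Walk H s t b) (cell₂ u v) (cell₂ u′ v′) Wᴴ
    where
    cell₁ : ∀ u v → proj₁ (cell (combine u v)) ≡ u
    cell₁ u v = cong proj₁ (remQuot-combine u v)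
    cell₂ : ∀ u v → proj₂ (cell (combine u v)) ≡ v
    cell₂ u v = cong proj₂ (remQuot-combine u v)

  dist-□ : Connected G → Connected H → ∀ u v u′ v′ →
           dist (G □ H) (combine u v) (combine u′ v′) ≡ dist G u u′ ℕ.+ dist H v v′
  dist-□ cG cH u v u′ v′ = ℕ.≤-antisym (dist-≤-length across) (sum≤dist across)
    where
    across : Walk (G □ H) (combine u v) (combine u′ v′) (dist G u u′ ℕ.+ dist H v v′)
    across = liftᴳ v (walk-of-length-dist (proj₂ (cG u u′))) ++ʷ liftᴴ u′ (walk-of-length-dist (proj₂ (cH v v′)))
    sum≤dist : ∀ {j} → Walk (G □ H) (combine u v) (combine u′ v′) j →
               dist G u u′ ℕ.+ dist H v v′ ℕ.≤ dist (G □ H) (combine u v) (combine u′ v′)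
    sum≤dist W =
      let a , b , a+b≡d , Wᴳ , Wᴴ = project-combine (walk-of-length-dist W)
      in subst (dist G u u′ ℕ.+ dist H v v′ ℕ.≤_) a+b≡d (ℕ.+-mono-≤ (dist-≤-length Wᴳ) (dist-≤-length Wᴴ))

-- Finite sums of rationals

ℕtoℚ-suc : ∀ k → ℕtoℚ (suc k) ≡ 1ℚ + ℕtoℚ k
-- Once ℕtoℚ k is rewritten to its normal form mkℚ (+ k) 0 _, adding 1ℚ computes.
ℕtoℚ-suc k = begin
  ℤ.+ suc k / 1                                      ≡⟨ cong (λ i → (ℤ.+ 1 ℤ.+ i) / 1) +◃k*1≡+k ⟨
  (ℤ.+ 1 ℤ.+ (Sign.+ ◃ (k ℕ.* 1))) / 1               ≡⟨⟩
  1ℚ + mkℚ (ℤ.+ k) 0 (Coprime.sym (1-coprimeTo k))  ≡⟨ cong (1ℚ +_) (normalize-coprime (Coprime.sym (1-coprimeTo k))) ⟨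
  1ℚ + ℕtoℚ k                                        ∎
  where
  open ≡-Reasoning
  +◃k*1≡+k : Sign.+ ◃ (k ℕ.* 1) ≡ ℤ.+ k
  +◃k*1≡+k = trans (cong (Sign.+ ◃_) (ℕ.*-identityʳ k)) (+◃n≡+n k)

0≤ℕtoℚ : ∀ k → 0ℚ ≤ ℕtoℚ k
0≤ℕtoℚ zero    = ≤-refl
0≤ℕtoℚ (suc k) = subst (0ℚ ≤_) (sym (ℕtoℚ-suc k)) (+-mono-≤ 0≤1 (0≤ℕtoℚ k))
  where
  0≤1 : 0ℚ ≤ 1ℚ
  0≤1 = *≤* (ℤ.+≤+ z≤n)

1≤ℕtoℚ : ∀ {k} → Fin k → 1ℚ ≤ ℕtoℚ k
1≤ℕtoℚ {suc k} _ = subst (1ℚ ≤_) (sym (ℕtoℚ-suc k)) (+-monoʳ-≤ 1ℚ (0≤ℕtoℚ k))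

sumℚ-cong : ∀ {k} {f g : Fin k → ℚ} → (∀ i → f i ≡ g i) → sumℚ f ≡ sumℚ g
sumℚ-cong {zero}  f≗g = refl
sumℚ-cong {suc k} f≗g = cong₂ _+_ (f≗g zero) (sumℚ-cong (f≗g ∘ suc))

sumℚ-mono-≤ : ∀ {k} {f g : Fin k → ℚ} → (∀ i → f i ≤ g i) → sumℚ f ≤ sumℚ g
sumℚ-mono-≤ {zero}  f≤g = ≤-refl
sumℚ-mono-≤ {suc k} f≤g = +-mono-≤ (f≤g zero) (sumℚ-mono-≤ (f≤g ∘ suc))

sumℚ-zero : ∀ k → sumℚ {k} (λ _ → 0ℚ) ≡ 0ℚ
sumℚ-zero zero    = refl
sumℚ-zero (suc k) = trans (+-identityˡ _) (sumℚ-zero k)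

sumℚ-nonneg : ∀ {k} {f : Fin k → ℚ} → (∀ i → 0ℚ ≤ f i) → 0ℚ ≤ sumℚ f
sumℚ-nonneg {k} {f} f≥0 = subst (_≤ sumℚ f) (sumℚ-zero k) (sumℚ-mono-≤ f≥0)

term≤sumℚ : ∀ {k} {f : Fin k → ℚ} → (∀ i → 0ℚ ≤ f i) → ∀ i → f i ≤ sumℚ f
term≤sumℚ {f = f} f≥0 zero =
  subst (_≤ sumℚ f) (+-identityʳ (f zero)) (+-monoʳ-≤ (f zero) (sumℚ-nonneg (f≥0 ∘ suc)))
term≤sumℚ {f = f} f≥0 (suc i) =
  ≤-trans (term≤sumℚ (f≥0 ∘ suc) i)
          (subst (_≤ sumℚ f) (+-identityˡ _) (+-monoˡ-≤ (sumℚ (f ∘ suc)) (f≥0 zero)))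

sumℚ-+ : ∀ {k} (f g : Fin k → ℚ) → sumℚ (λ i → f i + g i) ≡ sumℚ f + sumℚ g
sumℚ-+ {zero}  f g = refl
sumℚ-+ {suc k} f g =
  trans (cong (f zero + g zero +_) (sumℚ-+ (f ∘ suc) (g ∘ suc)))
        (interchange (f zero) (g zero) (sumℚ (f ∘ suc)) (sumℚ (g ∘ suc)))

sumℚ-*ˡ : ∀ {k} c (f : Fin k → ℚ) → sumℚ (λ i → c * f i) ≡ c * sumℚ f
sumℚ-*ˡ {zero}  c f = sym (*-zeroʳ c)
sumℚ-*ˡ {suc k} c f = trans (cong (c * f zero +_) (sumℚ-*ˡ c (f ∘ suc))) (sym (*-distribˡ-+ c _ _))

sumℚ-const : ∀ k a → sumℚ {k} (λ _ → a) ≡ ℕtoℚ k * a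
sumℚ-const zero    a = sym (*-zeroˡ a)
sumℚ-const (suc k) a = begin
  a + sumℚ {k} (λ _ → a)  ≡⟨ cong₂ _+_ (sym (*-identityˡ a)) (sumℚ-const k a) ⟩
  1ℚ * a + ℕtoℚ k * a     ≡⟨ *-distribʳ-+ a 1ℚ (ℕtoℚ k) ⟨
  (1ℚ + ℕtoℚ k) * a       ≡⟨ cong (_* a) (ℕtoℚ-suc k) ⟨
  ℕtoℚ (suc k) * a        ∎
  where open ≡-Reasoning

sumℚ-↑ : ∀ a b (F : Fin (a ℕ.+ b) → ℚ) →
         sumℚ F ≡ sumℚ {a} (λ i → F (i ↑ˡ b)) + sumℚ {b} (λ j → F (a ↑ʳ j))
sumℚ-↑ zero    b F = sym (+-identityˡ _)
sumℚ-↑ (suc a) b F =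
  trans (cong (F zero +_) (sumℚ-↑ a b (F ∘ suc)))
        (sym (+-assoc (F zero) (sumℚ {a} (λ i → F (suc (i ↑ˡ b)))) (sumℚ {b} (λ j → F (suc a ↑ʳ j)))))

sumℚ-combine : ∀ a b (F : Fin (a ℕ.* b) → ℚ) →
               sumℚ F ≡ sumℚ {a} (λ i → sumℚ {b} (λ j → F (combine i j)))
sumℚ-combine zero    b F = refl
sumℚ-combine (suc a) b F =
  trans (sumℚ-↑ b (a ℕ.* b) F)
        (cong (sumℚ {b} (λ j → F (combine {suc a} zero j)) +_) (sumℚ-combine a b (λ i → F (b ↑ʳ i))))

point : ∀ {k} → Fin k → ℚ → Fin k → ℚ
point i₀ t i = if does (i ≟ i₀) then t else 0ℚ

point-nonneg : ∀ {k} (i₀ : Fin k) {t} → 0ℚ ≤ t → ∀ i → 0ℚ ≤ point i₀ t i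
point-nonneg i₀ t≥0 i with does (i ≟ i₀)
... | true  = t≥0
... | false = ≤-refl

sumℚ-point : ∀ {k} (i₀ : Fin k) t → sumℚ (point i₀ t) ≡ t
sumℚ-point {suc k} zero     t = trans (cong (t +_) (sumℚ-zero k)) (+-identityʳ t)
sumℚ-point         (suc i₀) t = trans (+-identityˡ (sumℚ (point i₀ t))) (sumℚ-point i₀ t)

-- Spread weights

InUnitInterval : ∀ {k} → (Fin k → ℚ) → Set
InUnitInterval f = ∀ i → 0ℚ ≤ f i × f i ≤ 1ℚ

record Spread (m : ℚ) {k} (g q : Fin k → ℚ) : Set where
  field
    unit  : InUnitInterval q
    cover : ∀ i → g i ≤ m * q i
    mass  : 1ℚ ≤ sumℚ q

module _ {k} (m : ℚ) (1≤m : 1ℚ ≤ m) (g : Fin k → ℚ) (g-unit : InUnitInterval g) where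

  private
    instance
      m-pos : Positive m
      m-pos = positive (<-≤-trans (*<* (ℤ.+<+ (s≤s z≤n))) 1≤m)
      m≢0 : NonZero m
      m≢0 = pos⇒nonZero m
      1/m-pos : Positive (1/ m)
      1/m-pos = 1/pos⇒pos m

    c : ℚ
    c = 1/ m

    m*c*x≡x : ∀ x → m * (c * x) ≡ x
    m*c*x≡x x = trans (sym (*-assoc m c x)) (trans (cong (_* x) (*-inverseʳ m)) (*-identityˡ x))

    c*≤1 : ∀ {x} → x ≤ m → c * x ≤ 1ℚ
    c*≤1 x≤m = ≤-trans (*-monoˡ-≤-nonNeg c {{pos⇒nonNeg c}} x≤m) (≤-reflexive (*-inverseˡ m))

    c*-nonneg : ∀ {x} → 0ℚ ≤ x → 0ℚ ≤ c * x
    c*-nonneg {x} x≥0 = subst (_≤ c * x) (*-zeroʳ c) (*-monoˡ-≤-nonNeg c {{pos⇒nonNeg c}} x≥0)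

  spread-by-scaling : m ≤ sumℚ g → ∃ λ q → Spread m g q × m * sumℚ q ≡ sumℚ g ⊔ m
  spread-by-scaling m≤Σg = q , record { unit = unit ; cover = cover ; mass = mass } , total
    where
    q : Fin k → ℚ
    q i = c * g i
    Σq≡ : sumℚ q ≡ c * sumℚ g
    Σq≡ = sumℚ-*ˡ c g
    unit : InUnitInterval q
    unit i = c*-nonneg (proj₁ (g-unit i)) , c*≤1 (≤-trans (proj₂ (g-unit i)) 1≤m)
    cover : ∀ i → g i ≤ m * q i
    cover i = ≤-reflexive (sym (m*c*x≡x (g i)))
    mass : 1ℚ ≤ sumℚ q
    mass = begin
      1ℚ         ≡⟨ *-inverseˡ m ⟨
      c * m      ≤⟨ *-monoˡ-≤-nonNeg c {{pos⇒nonNeg c}} m≤Σg ⟩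
      c * sumℚ g ≡⟨ Σq≡ ⟨
      sumℚ q     ∎
      where open ≤-Reasoning
    total : m * sumℚ q ≡ sumℚ g ⊔ m
    total = trans (cong (m *_) Σq≡) (trans (m*c*x≡x (sumℚ g)) (sym (p≥q⇒p⊔q≡p m≤Σg)))

  spread-by-topping-up : Fin k → sumℚ g ≤ m → ∃ λ q → Spread m g q × m * sumℚ q ≡ sumℚ g ⊔ m
  spread-by-topping-up i₀ Σg≤m =
    q , record { unit = unit ; cover = cover ; mass = ≤-reflexive (sym Σq≡1) } , total
    where
    deficit : ℚ
    deficit = 1ℚ - c * sumℚ g
    deficit≥0 : 0ℚ ≤ deficit
    deficit≥0 = subst (_≤ deficit) (+-inverseʳ (c * sumℚ g)) (+-monoˡ-≤ (- (c * sumℚ g)) (c*≤1 Σg≤m))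
    q : Fin k → ℚ
    q i = c * g i + point i₀ deficit i
    Σq≡1 : sumℚ q ≡ 1ℚ
    Σq≡1 = begin
      sumℚ q                                          ≡⟨ sumℚ-+ (λ i → c * g i) (point i₀ deficit) ⟩
      sumℚ (λ i → c * g i) + sumℚ (point i₀ deficit)  ≡⟨ cong₂ _+_ (sumℚ-*ˡ c g) (sumℚ-point i₀ deficit) ⟩
      c * sumℚ g + (1ℚ - c * sumℚ g)                  ≡⟨ cong (c * sumℚ g +_) (+-comm 1ℚ (- (c * sumℚ g))) ⟩
      c * sumℚ g + (- (c * sumℚ g) + 1ℚ)              ≡⟨ +-assoc (c * sumℚ g) (- (c * sumℚ g)) 1ℚ ⟨
      c * sumℚ g - c * sumℚ g + 1ℚ                    ≡⟨ cong (_+ 1ℚ) (+-inverseʳ (c * sumℚ g)) ⟩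
      1ℚ                                              ∎
      where open ≡-Reasoning
    q≥0 : ∀ i → 0ℚ ≤ q i
    q≥0 i = +-mono-≤ (c*-nonneg (proj₁ (g-unit i))) (point-nonneg i₀ deficit≥0 i)
    unit : InUnitInterval q
    unit i = q≥0 i , subst (q i ≤_) Σq≡1 (term≤sumℚ q≥0 i)
    cover : ∀ i → g i ≤ m * q i
    cover i = begin
      g i                  ≡⟨ m*c*x≡x (g i) ⟨
      m * (c * g i)        ≤⟨ *-monoˡ-≤-nonNeg m {{pos⇒nonNeg m}} c*g≤q ⟩
      m * q i              ∎
      where
      open ≤-Reasoning
      c*g≤q : c * g i ≤ q i
      c*g≤q = subst (_≤ q i) (+-identityʳ (c * g i)) (+-monoʳ-≤ (c * g i) (point-nonneg i₀ deficit≥0 i))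
    total : m * sumℚ q ≡ sumℚ g ⊔ m
    total = trans (cong (m *_) Σq≡1) (trans (*-identityʳ m) (sym (p≤q⇒p⊔q≡q Σg≤m)))

  spread-exists : Fin k → ∃ λ q → Spread m g q × m * sumℚ q ≡ sumℚ g ⊔ m
  spread-exists i₀ with ≤-total m (sumℚ g)
  ... | inj₁ m≤Σg = spread-by-scaling m≤Σg
  ... | inj₂ Σg≤m = spread-by-topping-up i₀ Σg≤m

-- Resolving functions of the product

-- weightR G f x y is definitionally sumℚ (λ z → mask (dist G x z) (dist G y z) (f z)).
mask : ℕ → ℕ → ℚ → ℚ
mask a b x = if a ≡ᵇ b then 0ℚ else x

mask-≢ : ∀ {a b} x → a ≢ b → mask a b x ≡ x
mask-≢ {a} {b} x a≢b = cong (λ β → if β then 0ℚ else x) (dec-false (a ℕ.≟ b) a≢b)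

mask-mono : ∀ a b {x y} → x ≤ y → mask a b x ≤ mask a b y
mask-mono a b x≤y with a ≡ᵇ b
... | true  = ≤-refl
... | false = x≤y

mask-nonneg : ∀ a b {x} → 0ℚ ≤ x → 0ℚ ≤ mask a b x
mask-nonneg a b x≥0 with a ≡ᵇ b
... | true  = ≤-refl
... | false = x≥0

mask-*ˡ : ∀ a b c x → mask a b (c * x) ≡ c * mask a b x
mask-*ˡ a b c x with a ≡ᵇ b
... | true  = sym (*-zeroʳ c)
... | false = refl

mask-+ʳ : ∀ a b d x → mask (a ℕ.+ d) (b ℕ.+ d) x ≡ mask a b x
mask-+ʳ a b d x = cong (λ β → if β then 0ℚ else x)
  (does-⇔ (mk⇔ (ℕ.+-cancelʳ-≡ d a b) (cong (ℕ._+ d))) (a ℕ.+ d ℕ.≟ b ℕ.+ d) (a ℕ.≟ b))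

m≡n+o∧m+p≡n⇒o≡0 : ∀ {m n o p} → m ≡ n ℕ.+ o → m ℕ.+ p ≡ n → o ≡ 0
m≡n+o∧m+p≡n⇒o≡0 {m} {n} {o} {p} m≡n+o m+p≡n = ℕ.m+n≡0⇒m≡0 o (ℕ.+-cancelˡ-≡ n (o ℕ.+ p) 0 (begin
  n ℕ.+ (o ℕ.+ p) ≡⟨ ℕ.+-assoc n o p ⟨
  n ℕ.+ o ℕ.+ p   ≡⟨ cong (ℕ._+ p) m≡n+o ⟨
  m ℕ.+ p         ≡⟨ m+p≡n ⟩
  n               ≡⟨ ℕ.+-identityʳ n ⟨
  n ℕ.+ 0         ∎))
  where open ≡-Reasoning

module _ (G H : Graph) where

  liftWeight : (Fin (n G) → ℚ) → Fin (n (G □ H)) → ℚ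
  liftWeight q x = q (proj₁ (cell G H x))

  sumℚ-liftWeight : ∀ q → sumℚ (liftWeight q) ≡ ℕtoℚ (n H) * sumℚ q
  sumℚ-liftWeight q = begin
    sumℚ (liftWeight q)                                              ≡⟨ sumℚ-combine (n G) (n H) _ ⟩
    sumℚ {n G} (λ w → sumℚ {n H} (λ z → liftWeight q (combine w z))) ≡⟨ sumℚ-cong inner ⟩
    sumℚ (λ w → ℕtoℚ (n H) * q w)                                    ≡⟨ sumℚ-*ˡ (ℕtoℚ (n H)) q ⟩
    ℕtoℚ (n H) * sumℚ q                                              ∎
    where
    open ≡-Reasoning
    inner : ∀ w → sumℚ {n H} (λ z → liftWeight q (combine w z)) ≡ ℕtoℚ (n H) * q w
    inner w = trans (sumℚ-cong (λ z → cong (q ∘ proj₁) (remQuot-combine {n G} {n H} w z))) (sumℚ-const (n H) (q w))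

  fibreWeight : (Fin (n G) → ℚ) → (u u′ : Fin (n G)) (v v′ : Fin (n H)) → Fin (n G) → ℚ
  fibreWeight q u u′ v v′ w = sumℚ (λ z → mask (dist G u w ℕ.+ dist H v z) (dist G u′ w ℕ.+ dist H v′ z) (q w))

  weightR-□ : Connected G → Connected H → ∀ q u v u′ v′ →
              weightR (G □ H) (liftWeight q) (combine u v) (combine u′ v′) ≡ sumℚ (fibreWeight q u u′ v v′)
  weightR-□ cG cH q u v u′ v′ = trans (sumℚ-combine (n G) (n H) _) (sumℚ-cong λ w → sumℚ-cong λ z →
    trans (cong₂ (λ a b → mask a b _) (dist-□ G H cG cH u v w z) (dist-□ G H cG cH u′ v′ w z))
          (cong (mask (dist G u w ℕ.+ dist H v z) (dist G u′ w ℕ.+ dist H v′ z) ∘ q ∘ proj₁)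
                (remQuot-combine {n G} {n H} w z)))

  layers-separate : ∀ {v v′} → v ≢ v′ → ∀ a a′ →
                    (a ℕ.+ dist H v v ≢ a′ ℕ.+ dist H v′ v) ⊎ (a ℕ.+ dist H v v′ ≢ a′ ℕ.+ dist H v′ v′)
  layers-separate {v} {v′} v≢v′ a a′
    rewrite dist-refl {H} v | dist-refl {H} v′ | ℕ.+-identityʳ a | ℕ.+-identityʳ a′
    with a ℕ.≟ a′ ℕ.+ dist H v′ v
  ... | no  a≢ = inj₁ a≢
  ... | yes a≡ = inj₂ (dist-≢0 (v≢v′ ∘ sym) ∘ m≡n+o∧m+p≡n⇒o≡0 a≡)

  q≤fibreWeight : ∀ {q : Fin (n G) → ℚ} → (∀ w → 0ℚ ≤ q w) →
                  ∀ {u u′ v v′} → v ≢ v′ → ∀ w → q w ≤ fibreWeight q u u′ v v′ w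
  q≤fibreWeight {q} q≥0 {u} {u′} {v} {v′} v≢v′ w =
    [ term≤ v , term≤ v′ ]′ (layers-separate v≢v′ (dist G u w) (dist G u′ w))
    where
    term≤ : ∀ z → dist G u w ℕ.+ dist H v z ≢ dist G u′ w ℕ.+ dist H v′ z → q w ≤ fibreWeight q u u′ v v′ w
    term≤ z separated = subst (_≤ fibreWeight q u u′ v v′ w) (mask-≢ (q w) separated)
      (term≤sumℚ (λ z → mask-nonneg (dist G u w ℕ.+ dist H v z) (dist G u′ w ℕ.+ dist H v′ z) (q≥0 w)) z)

  mask≤fibreWeight : ∀ {g q : Fin (n G) → ℚ} → (∀ w → g w ≤ ℕtoℚ (n H) * q w) → ∀ u u′ v w →
                     mask (dist G u w) (dist G u′ w) (g w) ≤ fibreWeight q u u′ v v w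
  mask≤fibreWeight {g} {q} cover u u′ v w = begin
    mask a a′ (g w)                     ≤⟨ mask-mono a a′ (cover w) ⟩
    mask a a′ (ℕtoℚ (n H) * q w)        ≡⟨ mask-*ˡ a a′ (ℕtoℚ (n H)) (q w) ⟩
    ℕtoℚ (n H) * mask a a′ (q w)        ≡⟨ sumℚ-const (n H) (mask a a′ (q w)) ⟨
    sumℚ {n H} (λ _ → mask a a′ (q w))  ≡⟨ sumℚ-cong (λ z → mask-+ʳ a a′ (dist H v z) (q w)) ⟨
    fibreWeight q u u′ v v w            ∎
    where
    open ≤-Reasoning
    a a′ : ℕ
    a  = dist G u w
    a′ = dist G u′ w

  □-resolving : Connected G → Connected H → ∀ {g q : Fin (n G) → ℚ} → Resolving G g → Spread (ℕtoℚ (n H)) g q →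
                Resolving (G □ H) (liftWeight q)
  □-resolving cG cH {g} {q} (_ , g-resolves) spread = (λ x → unit (proj₁ (cell G H x))) , resolves
    where
    open Spread spread
    open ≤-Reasoning
    resolves-combine : ∀ u v u′ v′ → combine u v ≢ combine u′ v′ →
                       1ℚ ≤ weightR (G □ H) (liftWeight q) (combine u v) (combine u′ v′)
    resolves-combine u v u′ v′ X≢Y with v ≟ v′
    ... | no v≢v′ = begin
      1ℚ                                                           ≤⟨ mass ⟩
      sumℚ q                                                       ≤⟨ sumℚ-mono-≤ (q≤fibreWeight (proj₁ ∘ unit) v≢v′) ⟩
      sumℚ (fibreWeight q u u′ v v′)                               ≡⟨ weightR-□ cG cH q u v u′ v′ ⟨
      weightR (G □ H) (liftWeight q) (combine u v) (combine u′ v′) ∎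
    ... | yes refl = begin
      1ℚ                                                           ≤⟨ g-resolves u u′ (X≢Y ∘ cong (λ w → combine w v)) ⟩
      weightR G g u u′                                             ≤⟨ sumℚ-mono-≤ (mask≤fibreWeight cover u u′ v) ⟩
      sumℚ (fibreWeight q u u′ v v)                                ≡⟨ weightR-□ cG cH q u v u′ v ⟨
      weightR (G □ H) (liftWeight q) (combine u v) (combine u′ v) ∎
    resolves : ∀ x y → x ≢ y → 1ℚ ≤ weightR (G □ H) (liftWeight q) x y
    resolves x y x≢y = subst₂ (λ s t → 1ℚ ≤ weightR (G □ H) (liftWeight q) s t) (recombine x) (recombine y)
      (resolves-combine _ _ _ _ (x≢y ∘ subst₂ _≡_ (recombine x) (recombine y)))
      where
      recombine : ∀ x → combine (proj₁ (cell G H x)) (proj₂ (cell G H x)) ≡ x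
      recombine = combine-remQuot {n G} (n H)

fracDim-of-empty : ∀ {G d} → ¬ Fin (n G) → IsFracDim G d → d ≤ 0ℚ
fracDim-of-empty {G} no-vertex (_ , minimal) =
  subst (_ ≤_) (sumℚ-zero (n G)) (minimal (λ _ → 0ℚ) ((⊥-elim ∘ no-vertex) , λ x → ⊥-elim (no-vertex x)))

¬Fin⊎Fin : ∀ k → ¬ Fin k ⊎ Fin k
¬Fin⊎Fin zero    = inj₁ λ ()
¬Fin⊎Fin (suc k) = inj₂ zero

theorem4p2 : (G H : Graph) → Simple G → Simple H → Connected G → Connected H →
    (dG dGH : ℚ) → IsFracDim G dG → IsFracDim (G □ H) dGH →
    dGH ≤ dG ⊔ ℕtoℚ (n H)
theorem4p2 G H _ _ cG cH dG dGH ((g , g-resolving , Σg≡dG) , _) dGH-frac@(_ , dGH-minimal)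
  with ¬Fin⊎Fin (n G ℕ.* n H)
... | inj₁ no-vertex = ≤-trans (fracDim-of-empty no-vertex dGH-frac) (≤-trans (0≤ℕtoℚ (n H)) (p≤q⊔p dG _))
... | inj₂ x
  with u₀ , v₀ ← remQuot {n G} (n H) x
  with q , spread , total ← spread-exists (ℕtoℚ (n H)) (1≤ℕtoℚ v₀) g (proj₁ g-resolving) u₀ = begin
  dGH                      ≤⟨ dGH-minimal (liftWeight G H q) (□-resolving G H cG cH g-resolving spread) ⟩
  sumℚ (liftWeight G H q)  ≡⟨ sumℚ-liftWeight G H q ⟩
  ℕtoℚ (n H) * sumℚ q      ≡⟨ total ⟩
  sumℚ g ⊔ ℕtoℚ (n H)      ≡⟨ cong (_⊔ ℕtoℚ (n H)) Σg≡dG ⟩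
  dG ⊔ ℕtoℚ (n H)          ∎
  where open ≤-Reasoning
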